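{- Let $\gamma_\xi$ be the growing-causality event structure $(\{a,b,c\},\emptyset,\emptyset,\{a\lhd[b\to c]\})$. There is no extended bundle event structure (EBES) $\xi$ with $\mathrm{traces}(\xi)=\mathrm{traces}(\gamma_\xi)$.
   Context: A growing-causality event structure (GES) is a tuple $\gamma=(E,\#,\to,\lhd)$ with $E$ a set of events, $\#\subseteq E\times E$ irreflexive and symmetric, $\to\ \subseteq E\times E$ (initial causality), and $\lhd\subseteq E^3$; write $m\lhd[c\to t]$ when the occurrence of $m$ adds $c$ as a cause of $t$ (required to imply $\neg(c\to t)$). Let $ic(e)=\{e'\mid e'\to e\}$ and $ac(H,e)=\{e'\mid\exists a\in H.\ a\lhd[e'\to e]\}$. A trace of $\gamma$ is a finite sequence $e_1\cdots e_n$ of pairwise distinct events of $E$ with $\neg(e_i\#e_j)$ for all $i,j$ and $ic(e_i)\cup ac(\{e_1,\dots,e_{i-1}\},e_i)\subseteq\{e_1,\dots,e_{i-1}\}$ for all $i$. An EBES is a triple $\xi=(E,\leadsto,\mapsto)$ with $E$ a set of events, $\leadsto\ \subseteq E\times E$ the disabling relation ($x\leadsto y$ means $y$ can never precede $x$), and $\mapsto\ \subseteq 2^E\times E$ bundles satisfying stability: if $X\mapsto e$ then $e_1\leadsto e_2$ for all distinct $e_1,e_2\in X$. A trace of $\xi$ is a finite sequence $e_1\cdots e_n$ of pairwise distinct events of $E$ such that for all $i$: $X\cap\{e_1,\dots,e_{i-1}\}\neq\emptyset$ for every bundle $X\mapsto e_i$, and $\neg(e_i\leadsto e_j)$ for all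 $j<i$. -}

module Defs where

open import Level using (Level; _⊔_; suc)
open import Data.List using (List; []; _∷_; map; _++_; [_])
open import Data.List.Relation.Unary.Unique.Propositional using (Unique)
open import Data.List.Membership.Propositional using (_∈_)
open import Data.Product using (Σ; ∃; _×_; _,_)
open import Data.Empty using (⊥)
open import Relation.Nullary using (¬_)
open import Relation.Binary.PropositionalEquality using (_≡_)
open import Function.Definitions using (Injective)

record GES (ℓ : Level) : Set (suc ℓ) where
  field
    Ev     : Set ℓ
    _#_    : Ev → Ev → Set ℓ
    #-irrefl : ∀ e → ¬ (e # e)
    #-sym  : ∀ {e e'} → e # e' → e' # e
    _⇒_    : Ev → Ev → Set ℓ
    Grow   : Ev → Ev → Ev → Set ℓ            -- Grow m c t  :  m ⊲ [c → t]
    grow-new : ∀ {m c t} → Grow m c t → ¬ (c ⇒ t)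

module _ {ℓ} (γ : GES ℓ) where
  open GES γ
  record GTrace (tr : List Ev) : Set ℓ where
    field
      distinct : Unique tr
      conflictFree : ∀ {x y} → x ∈ tr → y ∈ tr → ¬ (x # y)
      causes : ∀ pre e post → tr ≡ pre ++ (e ∷ post) →
        (∀ {e'} → e' ⇒ e → e' ∈ pre) ×
        (∀ {e' a} → a ∈ pre → Grow a e' e → e' ∈ pre)

record EBES (ℓ : Level) : Set (suc ℓ) where
  field
    Ev      : Set ℓ
    _↝_     : Ev → Ev → Set ℓ              -- x ↝ y : y can never precede x
    -- bundles: an indexed family; bundle i is  set i ↦ target i
    -- (the relation ↦ ⊆ 2^E × E, each element given by an index)
    Bundle  : Set ℓ
    set     : Bundle → Ev → Set ℓ
    target  : Bundle → Ev
    stable  : ∀ i {e₁ e₂} → set i e₁ → set i e₂ → ¬ (e₁ ≡ e₂) → e₁ ↝ e₂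

module _ {ℓ} (ξ : EBES ℓ) where
  open EBES ξ
  record ETrace (tr : List Ev) : Set ℓ where
    field
      distinct : Unique tr
      enabled : ∀ pre e post → tr ≡ pre ++ (e ∷ post) →
        (∀ i → target i ≡ e → ∃ λ x → set i x × x ∈ pre) ×
        (∀ {e'} → e' ∈ pre → ¬ (e ↝ e'))

data ABC : Set where
  a b c : ABC

data GrowABC : ABC → ABC → ABC → Set where
  a⊲[b→c] : GrowABC a b c

γξ : GES Level.zero
γξ = record
  { Ev = ABC
  ; _#_ = λ _ _ → ⊥
  ; #-irrefl = λ _ ()
  ; #-sym = λ ()
  ; _⇒_ = λ _ _ → ⊥
  ; Grow = GrowABC
  ; grow-new = λ _ ()
  }

-- Trace-set equality of an EBES ξ with γ_ξ, where the events a,b,c of γ_ξ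
-- are identified with events of ξ via an injective map ι
-- (so ξ's event set contains {a,b,c}; no restriction on further events).
SameTraces : ∀ {ℓ} (ξ : EBES ℓ) → (ABC → EBES.Ev ξ) → Set ℓ
SameTraces ξ ι =
  (∀ (tr : List ABC) → GTrace γξ tr → ETrace ξ (map ι tr)) ×
  (∀ (tr : List (EBES.Ev ξ)) → ETrace ξ tr →
      ∃ λ (tr' : List ABC) → GTrace γξ tr' × tr ≡ map ι tr')

module Submission where

-- The GES γξ has a growing cause: once a has occurred, b becomes a cause of c.
-- Hence  c  alone and  a b c  are traces of γξ, but  a c  is not.  An EBES
-- cannot express this: its enabling conditions (bundles and disabling) of an
-- event do not depend on which events have already occurred.  Concretely,
--   * the trace  c  forces that no bundle points to c, and the trace  a b c
--     forces that no bundle points to a and that c does not disable a;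
--   * any two distinct events with these properties form an EBES trace;
-- so  ι a ι c  would be an EBES trace, hence (by trace equality and
-- injectivity of ι) a c would be a trace of γξ, which it is not.

open import Defs
open import Level using (Level)
open import Data.Product using (Σ; _×_; _,_; proj₁; proj₂)
open import Data.Empty using (⊥-elim)
open import Relation.Nullary using (¬_)
open import Function.Definitions using (Injective)
open import Relation.Binary.PropositionalEquality using (_≡_; refl; sym)
open import Data.List using (List; []; _∷_; _++_; map)
open import Data.List.Membership.Propositional using (_∈_)
open import Data.List.Relation.Unary.All using ([]; _∷_)
open import Data.List.Relation.Unary.Any using (here; there)
open import Data.List.Relation.Unary.AllPairs using ([]; _∷_)
open import Data.List.Properties using (map-injective)

module _ {ℓ} (ξ : EBES ℓ) where
  open EBES ξ

  -- The first event of an EBES trace has no bundle pointing to it: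
  -- such a bundle would have to meet the empty set of earlier events.
  first-unbundled : ∀ {e post} → ETrace ξ (e ∷ post) → ∀ i → ¬ (target i ≡ e)
  first-unbundled t i refl with proj₁ (ETrace.enabled t [] _ _ refl) i refl
  ... | _ , _ , ()

  later-not-disabling : ∀ {pre e post e'} → ETrace ξ (pre ++ e ∷ post) →
                        e' ∈ pre → ¬ (e ↝ e')
  later-not-disabling t = proj₂ (ETrace.enabled t _ _ _ refl)

  two-event-trace : ∀ {x y} → ¬ (x ≡ y) →
                    (∀ i → ¬ (target i ≡ x)) → (∀ i → ¬ (target i ≡ y)) →
                    ¬ (y ↝ x) → ETrace ξ (x ∷ y ∷ [])
  two-event-trace {x} {y} x≢y x-free y-free y↝̸x =
    record { distinct = (x≢y ∷ []) ∷ [] ∷ [] ; enabled = enabled }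
    where
    enabled : ∀ pre e post → x ∷ y ∷ [] ≡ pre ++ e ∷ post →
              (∀ i → target i ≡ e → Σ Ev λ z → set i z × z ∈ pre) ×
              (∀ {e'} → e' ∈ pre → ¬ (e ↝ e'))
    enabled []              _ _ refl = (λ i eq → ⊥-elim (x-free i eq)) , λ ()
    enabled (_ ∷ [])        _ _ refl = (λ i eq → ⊥-elim (y-free i eq))
                                     , λ { (here refl) → y↝̸x }
    enabled (_ ∷ _ ∷ [])    _ _ ()
    enabled (_ ∷ _ ∷ _ ∷ _) _ _ ()

open GES γξ using (_⇒_; Grow)

CausesIn : List ABC → ABC → Set
CausesIn pre e = (∀ {e'} → e' ⇒ e → e' ∈ pre) × (∀ {e' m} → m ∈ pre → Grow m e' e → e' ∈ pre)

trace-c : GTrace γξ (c ∷ [])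
trace-c = record { distinct = [] ∷ [] ; conflictFree = λ _ _ () ; causes = causes }
  where
  causes : ∀ pre e post → c ∷ [] ≡ pre ++ e ∷ post → CausesIn pre e
  causes []          _ _ refl = (λ ()) , λ ()
  causes (_ ∷ [])     _ _ ()
  causes (_ ∷ _ ∷ _) _ _ ()

-- a b c is a trace of γξ: the cause b added to c by a occurs before c.
trace-abc : GTrace γξ (a ∷ b ∷ c ∷ [])
trace-abc = record
  { distinct     = ((λ ()) ∷ (λ ()) ∷ []) ∷ ((λ ()) ∷ []) ∷ [] ∷ []
  ; conflictFree = λ _ _ ()
  ; causes       = causes
  }
  where
  causes : ∀ pre e post → a ∷ b ∷ c ∷ [] ≡ pre ++ e ∷ post → CausesIn pre e
  causes []                  _ _ refl = (λ ()) , λ {_} {_} _ ()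
  causes (_ ∷ [])            _ _ refl = (λ ()) , λ {_} {_} _ ()
  causes (_ ∷ _ ∷ [])        _ _ refl = (λ ()) , λ { {_} {_} _ a⊲[b→c] → there (here refl) }
  causes (_ ∷ _ ∷ _ ∷ [])    _ _ ()
  causes (_ ∷ _ ∷ _ ∷ _ ∷ _) _ _ ()

-- a c is not a trace of γξ: a adds the cause b to c, and b is missing.
not-trace-ac : ¬ GTrace γξ (a ∷ c ∷ [])
not-trace-ac t with proj₂ (GTrace.causes t (a ∷ []) c [] refl) (here refl) a⊲[b→c]
... | here ()
... | there ()

lemma12 : ∀ {ℓ : Level} → ¬ (Σ (EBES ℓ) λ ξ → Σ (ABC → EBES.Ev ξ) λ ι → Injective _≡_ _≡_ ι × SameTraces ξ ι)
lemma12 (ξ , ι , ι-inj , γ⊆ξ , ξ⊆γ) = not-trace-ac (preimage-is-ac (ξ⊆γ _ ξ-trace-ac))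
  where
  ξ-trace-abc : ETrace ξ (ι a ∷ ι b ∷ ι c ∷ [])
  ξ-trace-abc = γ⊆ξ _ trace-abc

  -- ι a ι c is a trace of ξ, by the facts forced by the traces  a b c  and  c.
  ξ-trace-ac : ETrace ξ (ι a ∷ ι c ∷ [])
  ξ-trace-ac = two-event-trace ξ (λ eq → a≢c (ι-inj eq))
    (first-unbundled ξ ξ-trace-abc) (first-unbundled ξ (γ⊆ξ _ trace-c))
    (later-not-disabling ξ {pre = ι a ∷ ι b ∷ []} ξ-trace-abc (here refl))
    where
    a≢c : ¬ (a ≡ c)
    a≢c ()

  preimage-is-ac : Σ (List ABC) (λ tr → GTrace γξ tr × (ι a ∷ ι c ∷ [] ≡ map ι tr)) →
                GTrace γξ (a ∷ c ∷ [])
  preimage-is-ac (tr , t , eq) with map-injective ι-inj (sym eq)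
  ... | refl = t
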